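{- Let $L\ge 2$ and $n\ge 2$ be integers and let $1\le h=h_1+h_2\le L^{\lfloor n/2\rfloor}$, where $h_1=\sum_{i=0}^{t}a_iL^{b_i}$ and $h_2=\sum_{i=0}^{s}a_i'L^{b_i'}$ with $a_i,a_i'\in\{1,2,\dots,L-1\}$ and $b_0>b_1>\dots>b_t>b_0'>b_1'>\dots>b_s'\ge 0$. Then $$ex_h(K_L^n)=ex_{h_1}(K_L^n)+ex_{h_2}(K_L^n)+2\Big(\sum_{i=0}^{t}a_i\Big)h_2 .$$
   Context: $K_L^n$ (the $L$-ary $n$-dimensional Hamming graph) is the graph whose vertices are the strings $x_nx_{n-1}\cdots x_1$ with $x_i\in\{0,1,\dots,L-1\}$, two strings being adjacent iff they differ in exactly one coordinate; it is $(L-1)n$-regular with $L^n$ vertices. For an integer $0\le m\le L^n$ with base-$L$ expansion $m=\sum_{i=0}^{s}a_iL^{b_i}$, $a_i\in\{1,\dots,L-1\}$, $b_0>b_1>\dots>b_s\ge0$, define $$ex_m(K_L^n)=\sum_{i=0}^{s}\big[(L-1)a_ib_iL^{b_i}+(a_i-1)a_iL^{b_i}\big]+2\sum_{i=0}^{s-1}\sum_{k=i+1}^{s}a_ia_kL^{b_k},$$ with $ex_0(K_L^n)=0$. (It is known that $ex_m(K_L^n)$ equals the maximum, over all $m$-vertex subsets $X$, of the degree sum $2|E(K_L^n[X])|$ of the induced subgraph.) -}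

module Defs where

open import Data.Nat using (ℕ; zero; suc; _+_; _*_; _∸_; _^_; _<_; _>_; _≤_; NonZero)
open import Data.Nat.DivMod using (_/_; _%_)
open import Data.Nat.Properties using (_≟_)
open import Data.List using (List; []; _∷_; map; filter; downFrom; sum)
open import Data.Product using (_×_; _,_; proj₁; proj₂)
open import Data.List.Relation.Unary.All using (All)
open import Data.List.Relation.Unary.Linked using (Linked)
open import Relation.Nullary using (¬_)
open import Relation.Nullary.Decidable using (¬?)

-- A term a·L^b of a base-L expansion is represented by the pair (a , b).
Term : Set
Term = ℕ × ℕ

value : ℕ → List Term → ℕ
value L [] = 0
value L ((a , b) ∷ ts) = a * L ^ b + value L ts

digitSum : List Term → ℕ
digitSum [] = 0
digitSum ((a , b) ∷ ts) = a + digitSum ts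

DigitsOK : ℕ → List Term → Set
DigitsOK L ts = All (λ t → 1 ≤ proj₁ t × proj₁ t ≤ L ∸ 1) ts

Decreasing : List Term → Set
Decreasing = Linked (λ t u → proj₂ t > proj₂ u)

digit : (L : ℕ) → .{{NonZero L}} → ℕ → ℕ → ℕ
digit L m i = (m / (L ^ i)) {{pow-nz}} % L
  where
  open import Data.Nat.Properties using (m^n≢0)
  pow-nz : NonZero (L ^ i)
  pow-nz = m^n≢0 L i

-- The (canonical) base-L expansion of m: the nonzero digits at positions
-- m, m-1, ..., 0 (highest exponent first); since L^(m+1) > m this covers all digits.
expansion : (L : ℕ) → .{{NonZero L}} → ℕ → List Term
expansion L m = filter (λ t → ¬? (proj₁ t ≟ 0))
                       (map (λ i → (digit L m i , i)) (downFrom (suc m)))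

-- The formula of the paper applied to an expansion (a_0,b_0),...,(a_s,b_s):
--   Σ_i [(L-1) a_i b_i L^{b_i} + (a_i - 1) a_i L^{b_i}] + 2 Σ_{i<k} a_i a_k L^{b_k}.
-- The double sum is unfolded recursively: the terms with first index i are
-- 2 a_i · Σ_{k>i} a_k L^{b_k} = 2 a_i · value (tail).
exList : ℕ → List Term → ℕ
exList L [] = 0
exList L ((a , b) ∷ ts) =
  (L ∸ 1) * a * b * L ^ b + (a ∸ 1) * a * L ^ b + 2 * a * value L ts + exList L ts

-- ex_m(K_L^n)  (the formula does not depend on n).
ex : (L : ℕ) → .{{NonZero L}} → ℕ → ℕ
ex L m = exList L (expansion L m)

{-# OPTIONS --safe #-}
module Submission where

open import Defs
open import Data.Nat using (ℕ; zero; suc; _+_; _*_; _∸_; _^_; _≤_; _<_; _/_; _%_; NonZero; >-nonZero⁻¹; z≤n; s≤s)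
open import Data.Nat.Properties
open import Data.Nat.DivMod
open import Data.Nat.Divisibility using (n∣m*n)
open import Data.Nat.Tactic.RingSolver using (solve-∀)
open import Data.List using (List; []; _∷_; _++_; map; filter; downFrom)
open import Data.List.Properties using (filter-accept; filter-reject)
open import Data.List.Relation.Unary.All using ([]; _∷_)
open import Data.List.Relation.Unary.All.Properties using (++⁺)
open import Data.List.Relation.Unary.Linked using ([-]; _∷_)
open import Data.Product using (_×_; _,_; proj₁; proj₂)
open import Data.Empty using (⊥-elim)
open import Relation.Nullary using (¬_; Dec; yes; no)
open import Relation.Nullary.Decidable using (¬?)
open import Relation.Binary.Definitions using (tri<; tri≈; tri>)
open import Relation.Binary.PropositionalEquality

-- A valid digit list is, by uniqueness of base-L expansions, the canonical
-- expansion of its value, so each  ex  in the identity is the closed formula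
-- exList  evaluated on the given digit lists.  On a concatenation  xs ++ ys
-- that formula splits into its values on xs and on ys plus the cross terms
-- 2 a_i a'_k L^{b'_k}, which sum to  2 · digitSum xs · value ys.

data ExpansionBelow (L : ℕ) : ℕ → List Term → Set where
  []  : ∀ {e} → ExpansionBelow L e []
  _∷_ : ∀ {e a b ts} → (1 ≤ a × a < L × b < e) → ExpansionBelow L b ts →
        ExpansionBelow L e ((a , b) ∷ ts)

m≤n∸1⇒m<n : ∀ {m n} .{{_ : NonZero n}} → m ≤ n ∸ 1 → m < n
m≤n∸1⇒m<n {n = suc _} = s≤s

module _ {L : ℕ} where

  ExpansionBelow-weaken : ∀ {e e′ ts} → e ≤ e′ → ExpansionBelow L e ts → ExpansionBelow L e′ ts
  ExpansionBelow-weaken e≤e′ []                      = []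
  ExpansionBelow-weaken e≤e′ ((a≥1 , a<L , b<e) ∷ p) = (a≥1 , a<L , ≤-trans b<e e≤e′) ∷ p

  ExpansionBelow-++⁻ : ∀ {e} xs {ys} → ExpansionBelow L e (xs ++ ys) →
                       ExpansionBelow L e xs × ExpansionBelow L e ys
  ExpansionBelow-++⁻ []       p                      = [] , p
  ExpansionBelow-++⁻ (_ ∷ xs) ((a≥1 , a<L , b<e) ∷ p) with ExpansionBelow-++⁻ xs p
  ... | pxs , pys = (a≥1 , a<L , b<e) ∷ pxs , ExpansionBelow-weaken (<⇒≤ b<e) pys

  fromDigitsOK : .{{NonZero L}} → ∀ {a b ts} → DigitsOK L ((a , b) ∷ ts) →
                 Decreasing ((a , b) ∷ ts) → ExpansionBelow L (suc b) ((a , b) ∷ ts)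
  fromDigitsOK ((a≥1 , a≤L∸1) ∷ [])         [-]          = (a≥1 , m≤n∸1⇒m<n a≤L∸1 , ≤-refl) ∷ []
  fromDigitsOK ((a≥1 , a≤L∸1) ∷ ok@(_ ∷ _)) (b′<b ∷ dec) =
    (a≥1 , m≤n∸1⇒m<n a≤L∸1 , ≤-refl) ∷ ExpansionBelow-weaken b′<b (fromDigitsOK ok dec)

coeff : List Term → ℕ → ℕ
coeff []             i = 0
coeff ((a , b) ∷ ts) i with b ≟ i
... | yes _ = a
... | no  _ = coeff ts i

coeff-head : ∀ a b ts → coeff ((a , b) ∷ ts) b ≡ a
coeff-head a b ts with b ≟ b
... | yes _  = refl
... | no b≢b = ⊥-elim (b≢b refl)

coeff-tail : ∀ {a b i} ts → b ≢ i → coeff ((a , b) ∷ ts) i ≡ coeff ts i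
coeff-tail {b = b} {i} ts b≢i with b ≟ i
... | yes b≡i = ⊥-elim (b≢i b≡i)
... | no  _   = refl

coeff-≥ : ∀ {L e i ts} → ExpansionBelow L e ts → e ≤ i → coeff ts i ≡ 0
coeff-≥ [] e≤i = refl
coeff-≥ {i = i} {(_ , b) ∷ ts} ((_ , _ , b<e) ∷ p) e≤i with b ≟ i
... | yes refl = ⊥-elim (<-irrefl refl (≤-trans b<e e≤i))
... | no  _    = coeff-≥ p (<⇒≤ (≤-trans b<e e≤i))

n<m^n : ∀ {m} → 1 < m → ∀ n → n < m ^ n
n<m^n 1<m zero    = s≤s z≤n
n<m^n 1<m (suc n) = ≤-<-trans (n<m^n 1<m n) (^-monoʳ-< _ 1<m (n<1+n n))

nonzero? : (t : Term) → Dec (¬ proj₁ t ≡ 0)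
nonzero? t = ¬? (proj₁ t ≟ 0)

module _ {L : ℕ} .{{_ : NonZero L}} where

  value<L^e : ∀ {e ts} → ExpansionBelow L e ts → value L ts < L ^ e
  value<L^e {e} [] = m^n>0 L e
  value<L^e {e} {(a , b) ∷ ts} ((_ , a<L , b<e) ∷ p) = begin-strict
    a * L ^ b + value L ts <⟨ +-monoʳ-< (a * L ^ b) (value<L^e p) ⟩
    a * L ^ b + L ^ b      ≡⟨ +-comm (a * L ^ b) (L ^ b) ⟩
    suc a * L ^ b          ≤⟨ *-monoˡ-≤ (L ^ b) a<L ⟩
    L ^ suc b              ≤⟨ ^-monoʳ-≤ L b<e ⟩
    L ^ e                  ∎
    where open ≤-Reasoning

  module _ (i : ℕ) where

    private instance
      L^i≢0 : NonZero (L ^ i)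
      L^i≢0 = m^n≢0 L i

    digit-*L^+ : ∀ k v → digit L (k * L ^ i + v) i ≡ (k + v / L ^ i) % L
    digit-*L^+ k v = cong (_% L) (begin
      (k * L ^ i + v) / L ^ i       ≡⟨ +-distrib-/-∣ˡ v {L ^ i} (n∣m*n k) ⟩
      k * L ^ i / L ^ i + v / L ^ i ≡⟨ cong (_+ v / L ^ i) (m*n/n≡m k (L ^ i)) ⟩
      k + v / L ^ i                 ∎)
      where open ≡-Reasoning

    digit-< : ∀ {m} → m < L ^ i → digit L m i ≡ 0
    digit-< m<L^i = trans (cong (_% L) (m<n⇒m/n≡0 m<L^i)) (m<n⇒m%n≡m (>-nonZero⁻¹ L))

    digit-leading : ∀ {a v} → a < L → v < L ^ i → digit L (a * L ^ i + v) i ≡ a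
    digit-leading {a} {v} a<L v<L^i = begin
      digit L (a * L ^ i + v) i ≡⟨ digit-*L^+ a v ⟩
      (a + v / L ^ i) % L       ≡⟨ cong (λ q → (a + q) % L) (m<n⇒m/n≡0 v<L^i) ⟩
      (a + 0) % L               ≡⟨ cong (_% L) (+-identityʳ a) ⟩
      a % L                     ≡⟨ m<n⇒m%n≡m a<L ⟩
      a                         ∎
      where open ≡-Reasoning

    digit-higher : ∀ q v → digit L (q * L ^ suc i + v) i ≡ digit L v i
    digit-higher q v = begin
      digit L (q * (L * L ^ i) + v) i ≡⟨ cong (λ x → digit L (x + v) i) (*-assoc q L (L ^ i)) ⟨
      digit L (q * L * L ^ i + v) i   ≡⟨ digit-*L^+ (q * L) v ⟩
      (q * L + v / L ^ i) % L         ≡⟨ cong (_% L) (+-comm (q * L) (v / L ^ i)) ⟩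
      (v / L ^ i + q * L) % L         ≡⟨ [m+kn]%n≡m%n (v / L ^ i) q L ⟩
      digit L v i                     ∎
      where open ≡-Reasoning

  digit-value : ∀ {e ts} → ExpansionBelow L e ts → ∀ i → digit L (value L ts) i ≡ coeff ts i
  digit-value [] i = digit-< i (m^n>0 L i)
  digit-value {ts = (a , b) ∷ ts} ((a≥1 , a<L , _) ∷ p′) i with <-cmp b i
  ... | tri< b<i _ _ = begin
    digit L (value L ((a , b) ∷ ts)) i ≡⟨ digit-< i (<-≤-trans (value<L^e p″) (^-monoʳ-≤ L b<i)) ⟩
    0                                  ≡⟨ coeff-≥ p″ b<i ⟨
    coeff ((a , b) ∷ ts) i             ∎
    where
    open ≡-Reasoning
    p″ : ExpansionBelow L (suc b) ((a , b) ∷ ts)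
    p″ = (a≥1 , a<L , ≤-refl) ∷ p′
  ... | tri≈ _ refl _ = trans (digit-leading b a<L (value<L^e p′)) (sym (coeff-head a b ts))
  ... | tri> _ b≢i i<b = begin
    digit L (a * L ^ b + value L ts) i     ≡⟨ cong (λ x → digit L (x + value L ts) i) a*L^b≡q*L^[1+i] ⟩
    digit L (q * L ^ suc i + value L ts) i ≡⟨ digit-higher i q (value L ts) ⟩
    digit L (value L ts) i                 ≡⟨ digit-value p′ i ⟩
    coeff ts i                             ≡⟨ coeff-tail ts b≢i ⟨
    coeff ((a , b) ∷ ts) i                 ∎
    where
    open ≡-Reasoning
    q : ℕ
    q = a * L ^ (b ∸ suc i)
    a*L^b≡q*L^[1+i] : a * L ^ b ≡ q * L ^ suc i
    a*L^b≡q*L^[1+i] = begin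
      a * L ^ b                         ≡⟨ cong (λ x → a * L ^ x) (m∸n+n≡m i<b) ⟨
      a * L ^ (b ∸ suc i + suc i)       ≡⟨ cong (a *_) (^-distribˡ-+-* L (b ∸ suc i) (suc i)) ⟩
      a * (L ^ (b ∸ suc i) * L ^ suc i) ≡⟨ *-assoc a _ _ ⟨
      q * L ^ suc i                     ∎

  -- expansion L m  is  nonzeroDigits m (suc m)  by definition.
  nonzeroDigits : ℕ → ℕ → List Term
  nonzeroDigits m k = filter nonzero? (map (λ i → (digit L m i , i)) (downFrom k))

  nonzeroDigits-coeff : ∀ {m k ts} → ExpansionBelow L k ts →
                        (∀ i → i < k → digit L m i ≡ coeff ts i) → nonzeroDigits m k ≡ ts
  nonzeroDigits-coeff {k = zero} [] agree = refl
  nonzeroDigits-coeff {k = suc k} [] agree =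
    trans (filter-reject nonzero? (λ digit≢0 → digit≢0 (agree k ≤-refl)))
          (nonzeroDigits-coeff [] (λ i i<k → agree i (m<n⇒m<1+n i<k)))
  nonzeroDigits-coeff {m} {suc k} {(a , b) ∷ ts} ((a≥1 , a<L , b<1+k) ∷ p) agree with b ≟ k
  ... | yes refl =
    trans (filter-accept nonzero? (λ digit≡0 → <-irrefl (trans (sym digit≡0) digit≡a) a≥1))
          (cong₂ _∷_ (cong (_, b) digit≡a)
                     (nonzeroDigits-coeff p λ i i<b →
                        trans (agree i (m<n⇒m<1+n i<b)) (coeff-tail ts (>⇒≢ i<b))))
    where
    digit≡a : digit L m b ≡ a
    digit≡a = trans (agree b ≤-refl) (coeff-head a b ts)
  ... | no b≢k =
    trans (filter-reject nonzero? (λ digit≢0 → digit≢0 digit≡0))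
          (nonzeroDigits-coeff ((a≥1 , a<L , b<k) ∷ p) (λ i i<k → agree i (m<n⇒m<1+n i<k)))
    where
    b<k : b < k
    b<k = ≤∧≢⇒< (≤-pred b<1+k) b≢k
    digit≡0 : digit L m k ≡ 0
    digit≡0 = trans (agree k ≤-refl) (trans (coeff-tail ts b≢k) (coeff-≥ p (<⇒≤ b<k)))

  ExpansionBelow-1+value : 1 < L → ∀ {e ts} → ExpansionBelow L e ts →
                           ExpansionBelow L (suc (value L ts)) ts
  ExpansionBelow-1+value 1<L [] = []
  ExpansionBelow-1+value 1<L {ts = (a , b) ∷ ts} ((a≥1 , a<L , _) ∷ p) =
    (a≥1 , a<L , s≤s b≤value) ∷ p
    where
    open ≤-Reasoning
    b≤value : b ≤ a * L ^ b + value L ts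
    b≤value = begin
      b                      ≤⟨ <⇒≤ (n<m^n 1<L b) ⟩
      L ^ b                  ≡⟨ *-identityˡ (L ^ b) ⟨
      1 * L ^ b              ≤⟨ *-monoˡ-≤ (L ^ b) a≥1 ⟩
      a * L ^ b              ≤⟨ m≤m+n (a * L ^ b) (value L ts) ⟩
      a * L ^ b + value L ts ∎

  expansion-value : 1 < L → ∀ {e ts} → ExpansionBelow L e ts → expansion L (value L ts) ≡ ts
  expansion-value 1<L p = nonzeroDigits-coeff (ExpansionBelow-1+value 1<L p) (λ i _ → digit-value p i)

  ex-value : 1 < L → ∀ {e ts} → ExpansionBelow L e ts → ex L (value L ts) ≡ exList L ts
  ex-value 1<L p = cong (exList L) (expansion-value 1<L p)

value-++ : ∀ L xs ys → value L (xs ++ ys) ≡ value L xs + value L ys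
value-++ L []             ys = refl
value-++ L ((a , b) ∷ xs) ys = trans (cong (a * L ^ b +_) (value-++ L xs ys)) (sym (+-assoc (a * L ^ b) _ _))

exList-++ : ∀ L xs ys → exList L (xs ++ ys) ≡ exList L xs + exList L ys + 2 * digitSum xs * value L ys
exList-++ L []             ys = sym (+-identityʳ _)
exList-++ L ((a , b) ∷ xs) ys = begin
  c + 2 * a * value L (xs ++ ys) + exList L (xs ++ ys)
    ≡⟨ cong₂ (λ v e → c + 2 * a * v + e) (value-++ L xs ys) (exList-++ L xs ys) ⟩
  c + 2 * a * (value L xs + value L ys) + (exList L xs + exList L ys + 2 * digitSum xs * value L ys)
    ≡⟨ regroup c a (value L xs) (value L ys) (exList L xs) (exList L ys) (digitSum xs) ⟩
  c + 2 * a * value L xs + exList L xs + exList L ys + 2 * (a + digitSum xs) * value L ys ∎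
  where
  open ≡-Reasoning
  c : ℕ
  c = (L ∸ 1) * a * b * L ^ b + (a ∸ 1) * a * L ^ b
  regroup : ∀ c a x y e f s →
            c + 2 * a * (x + y) + (e + f + 2 * s * y) ≡ c + 2 * a * x + e + f + 2 * (a + s) * y
  regroup = solve-∀

mainTheorem1 : (L n : ℕ) .{{_ : NonZero L}} → 2 ≤ L → 2 ≤ n →
    (h : ℕ) → 1 ≤ h → h ≤ L ^ (n / 2) →
    (a₀ b₀ a₀′ b₀′ : ℕ) (as₁ as₂ : List Term) →
    DigitsOK L ((a₀ , b₀) ∷ as₁) → DigitsOK L ((a₀′ , b₀′) ∷ as₂) →
    Decreasing (((a₀ , b₀) ∷ as₁) ++ ((a₀′ , b₀′) ∷ as₂)) →
    h ≡ value L ((a₀ , b₀) ∷ as₁) + value L ((a₀′ , b₀′) ∷ as₂) →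
    ex L h ≡ ex L (value L ((a₀ , b₀) ∷ as₁)) + ex L (value L ((a₀′ , b₀′) ∷ as₂))
             + 2 * digitSum ((a₀ , b₀) ∷ as₁) * value L ((a₀′ , b₀′) ∷ as₂)
mainTheorem1 L _ 2≤L _ _ _ _ a₀ b₀ a₀′ b₀′ as₁ as₂ ok₁ ok₂ dec refl = begin
  ex L (value L xs + value L ys)    ≡⟨ cong (ex L) (value-++ L xs ys) ⟨
  ex L (value L (xs ++ ys))         ≡⟨ ex-value 2≤L xs++ys-ok ⟩
  exList L (xs ++ ys)               ≡⟨ exList-++ L xs ys ⟩
  exList L xs + exList L ys + 2 * digitSum xs * value L ys
    ≡⟨ cong₂ (λ u w → u + w + 2 * digitSum xs * value L ys) (ex-value 2≤L xs-ok) (ex-value 2≤L ys-ok) ⟨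
  ex L (value L xs) + ex L (value L ys) + 2 * digitSum xs * value L ys ∎
  where
  open ≡-Reasoning
  xs ys : List Term
  xs = (a₀ , b₀) ∷ as₁
  ys = (a₀′ , b₀′) ∷ as₂
  xs++ys-ok : ExpansionBelow L (suc b₀) (xs ++ ys)
  xs++ys-ok = fromDigitsOK (++⁺ ok₁ ok₂) dec
  xs-ok : ExpansionBelow L (suc b₀) xs
  xs-ok = proj₁ (ExpansionBelow-++⁻ xs xs++ys-ok)
  ys-ok : ExpansionBelow L (suc b₀) ys
  ys-ok = proj₂ (ExpansionBelow-++⁻ xs xs++ys-ok)
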